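{- Let $Q$ be an odd squarefree positive integer and $P\ge Q$. For integers $n\ge3$ let $$\beta_{P,Q}(n)=\sum_{\substack{D,v\ge1,\ D\text{ a discriminant},\ Dv^2=n^2-4\\ p\mid v\Rightarrow p\le P}}\left(\frac1v\prod_{p\le P}\left(1-\frac{\chi_D(p)}{p}\right)^{ -1}\right)\prod_{q\mid Q}\begin{cases}2,&q^2\mid D,\\ 1+\left(\frac Dq\right),&q^2\nmid D.\end{cases}$$ For each prime $p$ define $$\beta_{(p,Q)}(n)=\sum_{b\ge0}\frac1{p^b}\left(1-\frac1p\chi_{(n^2-4)p^{ -2b}}(p)\right)^{ -1}\mathbb{I}_{p^b}(n),$$ where: for odd $p\nmid Q$, $\mathbb{I}_{p^b}(n)=1$ if $n^2\equiv4\pmod{p^{2b}}$ and $0$ otherwise; for $p=2$, $\mathbb{I}_{2^b}(n)=1$ if $n^2\equiv4\pmod{2^{2b}}$ and $(n^2-4)2^{ -2b}$ is a discriminant, and $0$ otherwise; for $q\mid Q$, $\mathbb{I}_{q^b}(n)=2$ if $n^2\equiv4\pmod{q^{2b}}$ and $q^2\mid(n^2-4)q^{ -2b}$, $\mathbb{I}_{q^b}(n)=1+\left(\frac{(n^2-4)q^{ -2b}}{q}\right)$ if $n^2\equiv4\pmod{q^{2b}}$ and $q^2\nmid(n^2-4)q^{ -2b}$, and $0$ otherwise. Then $$\beta_{P,Q}(n)=\prod_{\substack{p\le P\\ p\nmid Q}}\beta_{(p,Q)}(n)\cdot\prod_{q\mid Q}\beta_{(q,Q)}(n).$$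
   Context: $p,q$ denote primes. A discriminant is an integer $D\equiv0,1\pmod4$; for a discriminant $D$, $\chi_D(m)=\left(\frac Dm\right)$ is the Kronecker symbol; $\left(\frac{m}{q}\right)$ for odd $q$ is the Legendre symbol. Terms whose indicator $\mathbb{I}$ vanishes are zero regardless of the other factor. -}

module Defs where

open import Data.Nat as ℕ using (ℕ; zero; suc; _+_; _*_; _∸_; _^_; _≤_; _≤?_)
open import Data.Nat.DivMod using (_%_; _/_)
open import Data.Nat.Divisibility using (_∣_; _∣?_)
open import Data.Nat.Primality using (Prime; prime?)
open import Data.Integer as ℤ using (ℤ; +_; -[1+_])
open import Data.Rational as ℚ using (ℚ; 0ℚ; 1ℚ)
open import Data.Rational.Properties as ℚP using ()
open import Data.List using (List; []; _∷_; upTo; filter; map; foldr)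
open import Data.Bool.ListAction using (any; all)
open import Data.Bool using (Bool; true; false; if_then_else_; _∧_; _∨_; not)
open import Data.Sum using (_⊎_)
open import Relation.Nullary using (¬_; yes; no; ¬?; does)
open import Relation.Binary.PropositionalEquality using (_≡_)

-- Basic helpers (junk values only at divisor 0, which never occurs below
-- for the arguments that matter).

modN : ℕ → ℕ → ℕ
modN a zero    = a
modN a (suc k) = a % suc k

divN : ℕ → ℕ → ℕ
divN a zero    = 0
divN a (suc k) = a / suc k

fracZ : ℤ → ℕ → ℚ
fracZ z zero    = 0ℚ
fracZ z (suc k) = z ℚ./ suc k

recip : ℚ → ℚ
recip x with x ℚP.≟ 0ℚ
... | yes _  = 0ℚ
... | no x≢0 = ℚ.1/_ x {{ℚ.≢-nonZero x≢0}}

sumℚ : List ℚ → ℚ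
sumℚ = foldr ℚ._+_ 0ℚ

prodℚ : List ℚ → ℚ
prodℚ = foldr ℚ._*_ 1ℚ

IsDisc : ℕ → Set
IsDisc D = D % 4 ≡ 0 ⊎ D % 4 ≡ 1

isDiscᵇ : ℕ → Bool
isDiscᵇ D = (D % 4 ℕ.≡ᵇ 0) ∨ (D % 4 ℕ.≡ᵇ 1)

Odd : ℕ → Set
Odd n = ¬ (2 ∣ n)

Squarefree : ℕ → Set
Squarefree n = ∀ p → Prime p → ¬ (p * p ∣ n)

primesUpTo : ℕ → List ℕ
primesUpTo P = filter prime? (upTo (suc P))

-- prime divisors of Q (all ≤ Q when Q ≥ 1)
primeDivisors : ℕ → List ℕ
primeDivisors Q = filter (λ q → q ∣? Q) (primesUpTo Q)

-- every prime dividing v is ≤ P  (primes dividing v ≥ 1 are ≤ v)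
smoothᵇ : ℕ → ℕ → Bool
smoothᵇ P v = all (λ p → not (does (prime? p) ∧ does (p ∣? v)) ∨ does (p ≤? P)) (upTo (suc v))

isSqModᵇ : ℕ → ℕ → Bool
isSqModᵇ a q = any (λ x → modN (x * x) q ℕ.≡ᵇ modN a q) (upTo q)

legendre : ℕ → ℕ → ℤ
legendre a q with q ∣? a
... | yes _ = + 0
... | no  _ = if isSqModᵇ a q then + 1 else -[1+ 0 ]

kron2 : ℕ → ℤ
kron2 a with modN a 8
... | 1 = + 1
... | 7 = + 1
... | 3 = -[1+ 0 ]
... | 5 = -[1+ 0 ]
... | _ = + 0

chi : ℕ → ℕ → ℤ
chi D 2 = kron2 D
chi D p = legendre D p

eulerInv : ℕ → ℤ → ℚ
eulerInv p χ = recip (1ℚ ℚ.- fracZ χ p)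

ℕtoℚ : ℕ → ℚ
ℕtoℚ k = fracZ (+ k) 1

localQ : ℕ → ℕ → ℚ
localQ D q with (q * q) ∣? D
... | yes _ = ℕtoℚ 2
... | no  _ = fracZ (+ 1 ℤ.+ legendre D q) 1

disc : ℕ → ℕ
disc n = n * n ∸ 4

betaTerm : ℕ → ℕ → ℕ → ℕ → ℚ
betaTerm P Q n v =
  recip (ℕtoℚ v)
  ℚ.* prodℚ (map (λ p → eulerInv p (chi D p)) (primesUpTo P))
  ℚ.* prodℚ (map (localQ D) (primeDivisors Q))
  where D = divN (disc n) (v * v)

betaCondᵇ : ℕ → ℕ → ℕ → Bool
betaCondᵇ P n v =
  does (1 ≤? v) ∧ does ((v * v) ∣? disc n) ∧ isDiscᵇ (divN (disc n) (v * v)) ∧ smoothᵇ P v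

-- β_{P,Q}(n): the pairs (D,v) are determined by v, and v ≤ n² - 4
betaPQ : ℕ → ℕ → ℕ → ℚ
betaPQ P Q n =
  sumℚ (map (λ v → if betaCondᵇ P n v then betaTerm P Q n v else 0ℚ) (upTo (suc (disc n))))

indic : ℕ → ℕ → ℕ → ℕ → ℚ
indic Q p b n with (p ^ (2 * b)) ∣? disc n
... | no _ = 0ℚ
... | yes _ with p ∣? Q
...   | yes _ = localQ (divN (disc n) (p ^ (2 * b))) p
...   | no _ with p ℕ.≟ 2
...     | yes _ = if isDiscᵇ (divN (disc n) (p ^ (2 * b))) then 1ℚ else 0ℚ
...     | no _  = 1ℚ

betaLocTerm : ℕ → ℕ → ℕ → ℕ → ℚ
betaLocTerm p Q n b =
  recip (ℕtoℚ (p ^ b))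
  ℚ.* eulerInv p (chi (divN (disc n) (p ^ (2 * b))) p)
  ℚ.* indic Q p b n

-- β_{(p,Q)}(n) = Σ_{b ≥ 0} …; all terms with b > n² - 4 vanish
-- (p^{2b} > n²-4 > 0), so the sum is over 0 ≤ b ≤ n² - 4.
betaLoc : ℕ → ℕ → ℕ → ℚ
betaLoc p Q n = sumℚ (map (betaLocTerm p Q n) (upTo (suc (disc n))))

primesUpToCoprime : ℕ → ℕ → List ℕ
primesUpToCoprime P Q = filter (λ p → ¬? (p ∣? Q)) (primesUpTo P)

-- With m = n² − 4, the pairs (D, v) are indexed by the v with v² ∣ m. Every weight that
-- D = m / v² carries at a prime p (the Euler factor through χ_D(p), the factor at q ∣ Q,
-- and, for p = 2, being a discriminant) depends on D only up to squares prime to p, and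
-- for odd p the discriminant condition is automatic. Hence for v = pᵇ w with p ∤ w the
-- term of v is the b-th term of β_(p,Q)(n) times the term of w with p dropped from the
-- Euler product and from the smoothness condition. As v ↦ (b, w) is a bijection, the
-- p-local sum splits off as a factor; peeling off the primes p ≤ P one at a time yields
-- the product.
module Submission where

open import Defs
open import Algebra.Bundles using (CommutativeRing)
open import Data.Bool using (Bool; T; true; false; not; _∧_; _∨_; if_then_else_)
open import Data.Bool.ListAction using (all)
open import Data.Bool.Properties using (T-≡)
open import Data.Fin using (toℕ)
open import Data.Fin.Properties using (toℕ<n)
import Data.Integer as ℤ
import Data.Integer.Properties as ℤ
open import Data.List using (List; []; _∷_; _++_; [_]; map; upTo; applyUpTo; filter)
open import Data.List.Properties using (map-upTo; map-cong-local; upTo-∷ʳ; filter-++; filter-none; ++-identityʳ)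
open import Data.List.Membership.Propositional using (_∈_; _∉_; find; lose)
open import Data.List.Membership.Propositional.Properties using (∈-upTo⁺; ∈-upTo⁻; ∈-filter⁺; ∈-filter⁻)
open import Data.List.Relation.Unary.All as All using (All; []; _∷_)
import Data.List.Relation.Unary.All.Properties as All
open import Data.List.Relation.Unary.Any using (here; there)
open import Data.List.Relation.Unary.Any.Properties using (any⁺; any⁻; ¬Any[])
open import Data.List.Relation.Unary.Unique.Propositional using (Unique; []; _∷_)
import Data.List.Relation.Unary.Unique.Propositional.Properties as Unique
open import Data.Nat
open import Data.Nat.Coprimality using (Coprime; coprime-Bézout)
open import Data.Nat.Divisibility
open import Data.Nat.DivMod
open import Data.Nat.GCD using (module Bézout)
open import Data.Nat.Induction using (<-wellFounded)
open import Data.Nat.Primality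
open import Data.Nat.Primality.Factorisation using (factorise)
open import Data.Nat.Properties
open import Data.Nat.Tactic.RingSolver using (solve-∀)
open import Data.List.Membership.DecPropositional _≟_ using (_∈?_)
open import Data.Product using (∃; ∃₂; _×_; _,_; proj₁; proj₂)
open import Data.Rational using (ℚ; 0ℚ; 1ℚ; 1/_; mkℚ) renaming (_*_ to _·_)
import Data.Rational as ℚ
import Data.Rational.Properties as ℚ
open import Data.Sum using (inj₁; inj₂)
open import Data.Unit using (tt)
open import Function using (_∘_; _⇔_; mk⇔; Equivalence)
import Function.Properties.Equivalence as ⇔
open import Induction.WellFounded using (Acc; acc)
open import Relation.Binary.PropositionalEquality
  using (_≡_; _≢_; refl; sym; trans; cong; cong₂; subst; subst₂; module ≡-Reasoning)
open import Relation.Nullary using (¬_; Dec; yes; no; does; contradiction; _×-dec_; ¬?)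
open import Relation.Nullary.Decidable using (does-⇔; T?; dec-true; dec-false)
open import Relation.Unary using (Decidable)

open import Algebra.Properties.Semiring.Sum (CommutativeRing.semiring ℚ.+-*-commutativeRing)
  using (sum; *-distribˡ-sum; *-distribʳ-sum; sum-cong-≗; sum-replicate-zero)
  renaming (∑-comm to sum-comm)
open import Algebra.Properties.CommutativeSemigroup
  (CommutativeRing.*-commutativeSemigroup ℚ.+-*-commutativeRing) using (interchange; x∙yz≈y∙xz)

ind : Bool → ℚ → ℚ
ind b x = if b then x else 0ℚ

ind-0 : ∀ b → ind b 0ℚ ≡ 0ℚ
ind-0 true  = refl
ind-0 false = refl

ind-∧ : ∀ a b x → ind (a ∧ b) x ≡ ind a (ind b x)
ind-∧ true  b x = refl
ind-∧ false b x = refl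

ind-*ʳ : ∀ b x y → x · ind b y ≡ ind b (x · y)
ind-*ʳ true  x y = refl
ind-*ʳ false x y = ℚ.*-zeroʳ x

ind-∧-* : ∀ a b x y → ind (a ∧ b) (x · y) ≡ ind a x · ind b y
ind-∧-* true  true  x y = refl
ind-∧-* true  false x y = sym (ℚ.*-zeroʳ x)
ind-∧-* false b     x y = sym (ℚ.*-zeroˡ (ind b y))

ind-does-cong : ∀ {A : Set} (a? : Dec A) {b x y} → does a? ≡ b → (A → x ≡ y) → ind (does a?) x ≡ ind b y
ind-does-cong (yes a) refl x≡y = x≡y a
ind-does-cong (no _)  refl _   = refl

∑ : ℕ → (ℕ → ℚ) → ℚ
∑ K f = sum {K} (f ∘ toℕ)

sumℚ-applyUpTo : ∀ (f : ℕ → ℚ) K → sumℚ (applyUpTo f K) ≡ ∑ K f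
sumℚ-applyUpTo f zero    = refl
sumℚ-applyUpTo f (suc K) = cong (f 0 ℚ.+_) (sumℚ-applyUpTo (f ∘ suc) K)

sumℚ-map-upTo : ∀ (f : ℕ → ℚ) K → sumℚ (map f (upTo K)) ≡ ∑ K f
sumℚ-map-upTo f K = trans (cong sumℚ (map-upTo f K)) (sumℚ-applyUpTo f K)

∑-cong : ∀ K {f g : ℕ → ℚ} → (∀ {i} → i < K → f i ≡ g i) → ∑ K f ≡ ∑ K g
∑-cong K f≡g = sum-cong-≗ (λ i → f≡g (toℕ<n i))

∑-zero : ∀ K {f : ℕ → ℚ} → (∀ {i} → i < K → f i ≡ 0ℚ) → ∑ K f ≡ 0ℚ
∑-zero K f≡0 = trans (∑-cong K f≡0) (sum-replicate-zero K)

∑-comm : ∀ K J (f : ℕ → ℕ → ℚ) → ∑ K (λ i → ∑ J (f i)) ≡ ∑ J (λ j → ∑ K (λ i → f i j))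
∑-comm K J f = sum-comm {K} {J} (λ i j → f (toℕ i) (toℕ j))

∑-*-∑ : ∀ K J (f g : ℕ → ℚ) → ∑ K (λ i → ∑ J (λ j → f i · g j)) ≡ ∑ K f · ∑ J g
∑-*-∑ K J f g = sym (trans (*-distribʳ-sum {K} (∑ J g) (f ∘ toℕ))
                           (sum-cong-≗ {K} (λ i → *-distribˡ-sum {J} (f (toℕ i)) (g ∘ toℕ))))

∑-ind : ∀ b K (f : ℕ → ℚ) → ∑ K (λ i → ind b (f i)) ≡ ind b (∑ K f)
∑-ind true  K f = refl
∑-ind false K f = sum-replicate-zero K

∑-δ : ∀ K u {f : ℕ → ℚ} → (K ≤ u → f u ≡ 0ℚ) → ∑ K (λ i → ind (does (i ≟ u)) (f i)) ≡ f u
∑-δ zero    u           f≡0 = sym (f≡0 z≤n)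
∑-δ (suc K) zero    {f} f≡0 = trans (cong (f 0 ℚ.+_) (sum-replicate-zero K)) (ℚ.+-identityʳ (f 0))
∑-δ (suc K) (suc u) {f} f≡0 = trans (ℚ.+-identityˡ _) (∑-δ K u {f ∘ suc} (f≡0 ∘ s≤s))

prodℚ-cong : ∀ {f g : ℕ → ℚ} {xs} → All (λ x → f x ≡ g x) xs → prodℚ (map f xs) ≡ prodℚ (map g xs)
prodℚ-cong f≡g = cong prodℚ (map-cong-local f≡g)

prodℚ-map-* : ∀ (f g : ℕ → ℚ) xs →
              prodℚ (map (λ x → f x · g x) xs) ≡ prodℚ (map f xs) · prodℚ (map g xs)
prodℚ-map-* f g []       = refl
prodℚ-map-* f g (x ∷ xs) = trans (cong (f x · g x ·_) (prodℚ-map-* f g xs)) (interchange (f x) (g x) _ _)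

prodℚ-filter : ∀ {P : ℕ → Set} (P? : Decidable P) (f : ℕ → ℚ) xs →
               prodℚ (map (λ x → if does (P? x) then f x else 1ℚ) xs) ≡ prodℚ (map f (filter P? xs))
prodℚ-filter P? f [] = refl
prodℚ-filter P? f (x ∷ xs) with P? x
... | yes _ = cong (f x ·_) (prodℚ-filter P? f xs)
... | no  _ = trans (ℚ.*-identityˡ _) (prodℚ-filter P? f xs)

prodℚ-partition : ∀ {P : ℕ → Set} (P? : Decidable P) (f : ℕ → ℚ) xs →
                  prodℚ (map f xs) ≡ prodℚ (map f (filter (¬? ∘ P?) xs)) · prodℚ (map f (filter P? xs))
prodℚ-partition P? f [] = refl
prodℚ-partition P? f (x ∷ xs) with P? x
... | yes _ = trans (cong (f x ·_) (prodℚ-partition P? f xs))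
                    (x∙yz≈y∙xz (f x) (prodℚ (map f (filter (¬? ∘ P?) xs))) (prodℚ (map f (filter P? xs))))
... | no  _ = trans (cong (f x ·_) (prodℚ-partition P? f xs))
                    (sym (ℚ.*-assoc (f x) (prodℚ (map f (filter (¬? ∘ P?) xs))) (prodℚ (map f (filter P? xs)))))

1/-unique : ∀ x .{{_ : ℚ.NonZero x}} {y} → x · y ≡ 1ℚ → y ≡ 1/ x
1/-unique x {y} xy≡1 = begin
  y               ≡⟨ ℚ.*-identityˡ y ⟨
  1ℚ · y          ≡⟨ cong (_· y) (ℚ.*-inverseˡ x) ⟨
  1/ x · x · y    ≡⟨ ℚ.*-assoc (1/ x) x y ⟩
  1/ x · (x · y)  ≡⟨ cong (1/ x ·_) xy≡1 ⟩
  1/ x · 1ℚ       ≡⟨ ℚ.*-identityʳ (1/ x) ⟩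
  1/ x            ∎
  where open ≡-Reasoning

recip-≢0 : ∀ x (x≢0 : x ≢ 0ℚ) → recip x ≡ (1/ x) {{ℚ.≢-nonZero x≢0}}
recip-≢0 x x≢0 with x ℚ.≟ 0ℚ
... | yes x≡0 = contradiction x≡0 x≢0
... | no  _   = refl

recip-* : ∀ x y → recip (x · y) ≡ recip x · recip y
recip-* x y with x ℚ.≟ 0ℚ
... | yes refl = trans (cong recip (ℚ.*-zeroˡ y)) (sym (ℚ.*-zeroˡ (recip y)))
... | no x≢0 with y ℚ.≟ 0ℚ
...   | yes refl = trans (cong recip (ℚ.*-zeroʳ x)) (sym (ℚ.*-zeroʳ (1/ x)))
    where instance _ = ℚ.≢-nonZero x≢0
...   | no y≢0   = trans (recip-≢0 (x · y) xy≢0) (sym (1/-unique (x · y) {{ℚ.≢-nonZero xy≢0}} xy·z≡1))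
  where
  instance
    _ = ℚ.≢-nonZero x≢0
    _ = ℚ.≢-nonZero y≢0
  xy·z≡1 : x · y · (1/ x · 1/ y) ≡ 1ℚ
  xy·z≡1 = trans (interchange x y (1/ x) (1/ y)) (cong₂ _·_ (ℚ.*-inverseʳ x) (ℚ.*-inverseʳ y))
  xy≢0 : x · y ≢ 0ℚ
  xy≢0 xy≡0 = ℚ.1≢0 (trans (sym xy·z≡1) (trans (cong (_· (1/ x · 1/ y)) xy≡0) (ℚ.*-zeroˡ (1/ x · 1/ y))))

ℕtoℚ-* : ∀ a b → ℕtoℚ (a * b) ≡ ℕtoℚ a · ℕtoℚ b
ℕtoℚ-* a b = trans (cong (ℚ._/ 1) (ℤ.pos-* a b)) (sym (cong₂ _·_ (ℕtoℚ≡mkℚ a) (ℕtoℚ≡mkℚ b)))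
  where
  ℕtoℚ≡mkℚ : ∀ k → ℕtoℚ k ≡ mkℚ (ℤ.+ k) 0 (λ (_ , d∣1) → ∣1⇒≡1 d∣1)
  ℕtoℚ≡mkℚ k = ℚ.normalize-coprime _

recip-ℕtoℚ-* : ∀ a b → recip (ℕtoℚ (a * b)) ≡ recip (ℕtoℚ a) · recip (ℕtoℚ b)
recip-ℕtoℚ-* a b = trans (cong recip (ℕtoℚ-* a b)) (recip-* (ℕtoℚ a) (ℕtoℚ b))

prime⇒≥2 : ∀ {p} → Prime p → 2 ≤ p
prime⇒≥2 {p} p-prime = nonTrivial⇒n>1 p {{prime⇒nonTrivial p-prime}}

n<m^n : ∀ {m} → 2 ≤ m → ∀ n → n < m ^ n
n<m^n m≥2 zero        = s≤s z≤n
n<m^n {m} m≥2 (suc n) = begin-strict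
  suc n      ≤⟨ n<m^n m≥2 n ⟩
  m ^ n      <⟨ m<m*n (m ^ n) m {{>-nonZero (<-≤-trans z<s (n<m^n m≥2 n))}} m≥2 ⟩
  m ^ n * m  ≡⟨ *-comm (m ^ n) m ⟩
  m ^ suc n  ∎
  where open ≤-Reasoning

^-double : ∀ p b → p ^ (2 * b) ≡ p ^ b * p ^ b
^-double p b = trans (^-distribˡ-+-* p b (b + 0)) (cong (λ c → p ^ b * p ^ c) (+-identityʳ b))

divN-* : ∀ s d → .{{NonZero d}} → divN (s * d) d ≡ s
divN-* s (suc d) = m*n/n≡m s (suc d)

¬p∣w⇒w≢0 : ∀ {p w} → ¬ p ∣ w → NonZero w
¬p∣w⇒w≢0 {p} {zero}  p∤0 = contradiction (p ∣0) p∤0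
¬p∣w⇒w≢0 {w = suc _} _   = _

prime∣m*m⇒prime∣m : ∀ {p m} → Prime p → p ∣ m * m → p ∣ m
prime∣m*m⇒prime∣m {m = m} p-prime p∣m*m with euclidsLemma m m p-prime p∣m*m
... | inj₁ p∣m = p∣m
... | inj₂ p∣m = p∣m

prime∣p^b⇒≡ : ∀ {q p} → Prime q → Prime p → ∀ b → q ∣ p ^ b → q ≡ p
prime∣p^b⇒≡ q-prime p-prime zero q∣1 = contradiction (subst Prime (∣1⇒≡1 q∣1) q-prime) ¬prime[1]
prime∣p^b⇒≡ {p = p} q-prime p-prime (suc b) q∣p^1+b with euclidsLemma p (p ^ b) q-prime q∣p^1+b
... | inj₂ q∣p^b = prime∣p^b⇒≡ q-prime p-prime b q∣p^b
... | inj₁ q∣p with prime⇒irreducible p-prime q∣p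
...   | inj₁ q≡1 = contradiction (subst Prime q≡1 q-prime) ¬prime[1]
...   | inj₂ q≡p = q≡p

p^k∣m*n⇒p^k∣n : ∀ {p m} → Prime p → ¬ p ∣ m → ∀ k {n} → p ^ k ∣ m * n → p ^ k ∣ n
p^k∣m*n⇒p^k∣n p-prime p∤m zero {n} _ = 1∣ n
p^k∣m*n⇒p^k∣n {p} {m} p-prime p∤m (suc k) {n} p^1+k∣mn
  with euclidsLemma m n p-prime (m*n∣⇒m∣ p (p ^ k) p^1+k∣mn)
... | inj₁ p∣m = contradiction p∣m p∤m
... | inj₂ (divides n′ refl) = subst (p * p ^ k ∣_) (*-comm p n′) (*-monoʳ-∣ p p^k∣n′)
  where
  instance _ = prime⇒nonZero p-prime
  reassoc : ∀ m n′ p → m * (n′ * p) ≡ p * (m * n′)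
  reassoc = solve-∀
  p^k∣n′ : p ^ k ∣ n′
  p^k∣n′ = p^k∣m*n⇒p^k∣n p-prime p∤m k (*-cancelˡ-∣ p (subst (p * p ^ k ∣_) (reassoc m n′ p) p^1+k∣mn))

p-adicSplit : ∀ {p} → Prime p → ∀ v → .{{NonZero v}} → ∃₂ λ e w → ¬ p ∣ w × v ≡ p ^ e * w
p-adicSplit {p} p-prime v = go v (<-wellFounded v)
  where
  reassoc : ∀ x w p → x * w * p ≡ p * x * w
  reassoc = solve-∀
  go : ∀ v → .{{NonZero v}} → Acc _<_ v → ∃₂ λ e w → ¬ p ∣ w × v ≡ p ^ e * w
  go v (acc rec) with p ∣? v
  ... | no  p∤v = 0 , v , p∤v , sym (*-identityˡ v)
  ... | yes (divides k refl) with go k {{k≢0}} (rec (m<m*n k p {{k≢0}} (prime⇒≥2 p-prime)))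
    where k≢0 = m*n≢0⇒m≢0 k
  ...   | e , w , p∤w , refl = suc e , w , p∤w , reassoc (p ^ e) w p

p-adicSplit-unique : ∀ {p} → Prime p → ∀ b e {w w′} → ¬ p ∣ w → ¬ p ∣ w′ →
                     p ^ b * w ≡ p ^ e * w′ → b ≡ e × w ≡ w′
p-adicSplit-unique p-prime zero zero {w} {w′} _ _ eq =
  refl , trans (sym (*-identityˡ w)) (trans eq (*-identityˡ w′))
p-adicSplit-unique {p} p-prime zero (suc e) {w} {w′} p∤w _ eq =
  contradiction (subst (p ∣_) (sym (trans (sym (*-identityˡ w)) eq)) (∣m⇒∣m*n w′ (m∣m*n (p ^ e)))) p∤w
p-adicSplit-unique {p} p-prime (suc b) zero {w} {w′} _ p∤w′ eq =
  contradiction (subst (p ∣_) (trans eq (*-identityˡ w′)) (∣m⇒∣m*n w (m∣m*n (p ^ b)))) p∤w′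
p-adicSplit-unique {p} p-prime (suc b) (suc e) {w} {w′} p∤w p∤w′ eq
  with p-adicSplit-unique p-prime b e p∤w p∤w′
         (*-cancelˡ-≡ _ _ p {{prime⇒nonZero p-prime}}
           (trans (sym (*-assoc p (p ^ b) w)) (trans eq (*-assoc p (p ^ e) w′))))
... | refl , w≡w′ = refl , w≡w′

p-adicParts< : ∀ {p e w K} → Prime p → .{{NonZero w}} → p ^ e * w < K → e < K × w < K
p-adicParts< {p} {e} {w} {K} p-prime p^e*w<K = e<K , w<K
  where
  instance _ = m^n≢0 p e {{prime⇒nonZero p-prime}}
  open ≤-Reasoning
  e<K : e < K
  e<K = begin-strict
    e          <⟨ n<m^n (prime⇒≥2 p-prime) e ⟩
    p ^ e      ≤⟨ m≤m*n (p ^ e) w ⟩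
    p ^ e * w  <⟨ p^e*w<K ⟩
    K          ∎
  w<K : w < K
  w<K = begin-strict
    w          ≤⟨ m≤n*m w (p ^ e) ⟩
    p ^ e * w  <⟨ p^e*w<K ⟩
    K          ∎

noPrimeDivisor⇒≡1 : ∀ {v} → .{{NonZero v}} → (∀ {q} → Prime q → ¬ q ∣ v) → v ≡ 1
noPrimeDivisor⇒≡1 {v} noPrime with factorise v
... | record { factors = []     ; isFactorisation = v≡1 } = v≡1
... | record { factors = q ∷ qs ; isFactorisation = v≡q*qs ; factorsPrime = q-prime ∷ _ } =
  contradiction (subst (q ∣_) (sym v≡q*qs) (m∣m*n _)) (noPrime q-prime)

-- Each 0 < v < K is pᵇ w with p ∤ w for exactly one pair (b, w), and then b, w < K.
module _ {p} (p-prime : Prime p) (K : ℕ) (G : ℕ → ℚ) where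

  private
    G-at : ℕ → ℕ → ℕ → ℚ
    G-at b w v = ind (does (v ≟ p ^ b * w)) (ind (does (¬? (p ∣? w))) (G v))

    G-at≡δ : ∀ {v e w₀} → ¬ p ∣ w₀ → v ≡ p ^ e * w₀ →
             ∀ b w → G-at b w v ≡ ind (does (b ≟ e)) (ind (does (w ≟ w₀)) (G v))
    G-at≡δ {v} {e} {w₀} p∤w₀ v≡p^e*w₀ b w = begin
      G-at b w v
        ≡⟨ ind-∧ (does (v ≟ p ^ b * w)) (does (¬? (p ∣? w))) (G v) ⟨
      ind (does ((v ≟ p ^ b * w) ×-dec ¬? (p ∣? w))) (G v)
        ≡⟨ cong (λ c → ind c (G v))
             (does-⇔ split⇔ ((v ≟ p ^ b * w) ×-dec ¬? (p ∣? w)) ((b ≟ e) ×-dec (w ≟ w₀))) ⟩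
      ind (does ((b ≟ e) ×-dec (w ≟ w₀))) (G v)
        ≡⟨ ind-∧ (does (b ≟ e)) (does (w ≟ w₀)) (G v) ⟩
      ind (does (b ≟ e)) (ind (does (w ≟ w₀)) (G v)) ∎
      where
      open ≡-Reasoning
      split⇔ : (v ≡ p ^ b * w × ¬ p ∣ w) ⇔ (b ≡ e × w ≡ w₀)
      split⇔ = mk⇔
        (λ (v≡p^b*w , p∤w) → p-adicSplit-unique p-prime b e p∤w p∤w₀ (trans (sym v≡p^b*w) v≡p^e*w₀))
        (λ { (refl , refl) → v≡p^e*w₀ , p∤w₀ })

    ∑-p-adic-expand : G 0 ≡ 0ℚ → ∀ {v} → v < K → ∑ K (λ b → ∑ K (λ w → G-at b w v)) ≡ G v
    ∑-p-adic-expand G0≡0 {zero} _ = trans (∑-zero K λ {b} _ → ∑-zero K λ {w} _ → G-at0≡0 b w) (sym G0≡0)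
      where
      G-at0≡0 : ∀ b w → G-at b w 0 ≡ 0ℚ
      G-at0≡0 b w = trans (cong (λ g → ind c (ind c′ g)) G0≡0) (trans (cong (ind c) (ind-0 c′)) (ind-0 c))
        where
        c = does (0 ≟ p ^ b * w)
        c′ = does (¬? (p ∣? w))
    ∑-p-adic-expand _ {v@(suc _)} v<K with p-adicSplit p-prime v
    ... | e , w₀ , p∤w₀ , v≡p^e*w₀ = begin
      ∑ K (λ b → ∑ K (λ w → G-at b w v))
        ≡⟨ ∑-cong K (λ {b} _ → ∑-cong K (λ {w} _ → G-at≡δ p∤w₀ v≡p^e*w₀ b w)) ⟩
      ∑ K (λ b → ∑ K (λ w → ind (does (b ≟ e)) (ind (does (w ≟ w₀)) (G v))))
        ≡⟨ ∑-cong K (λ {b} _ → ∑-ind (does (b ≟ e)) K (λ w → ind (does (w ≟ w₀)) (G v))) ⟩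
      ∑ K (λ b → ind (does (b ≟ e)) (∑ K (λ w → ind (does (w ≟ w₀)) (G v))))
        ≡⟨ ∑-δ K e {λ _ → ∑ K (λ w → ind (does (w ≟ w₀)) (G v))}
               (λ K≤e → contradiction K≤e (<⇒≱ e<K)) ⟩
      ∑ K (λ w → ind (does (w ≟ w₀)) (G v))
        ≡⟨ ∑-δ K w₀ {λ _ → G v} (λ K≤w₀ → contradiction K≤w₀ (<⇒≱ w₀<K)) ⟩
      G v ∎
      where
      open ≡-Reasoning
      e<K×w₀<K : e < K × w₀ < K
      e<K×w₀<K = p-adicParts< p-prime {{¬p∣w⇒w≢0 p∤w₀}} (subst (_< K) v≡p^e*w₀ v<K)
      e<K = proj₁ e<K×w₀<K
      w₀<K = proj₂ e<K×w₀<K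

  ∑-p-adic : G 0 ≡ 0ℚ → (∀ {v} → K ≤ v → G v ≡ 0ℚ) →
             ∑ K G ≡ ∑ K (λ b → ∑ K (λ w → ind (does (¬? (p ∣? w))) (G (p ^ b * w))))
  ∑-p-adic G0≡0 G-vanishes = begin
    ∑ K G
      ≡⟨ ∑-cong K (∑-p-adic-expand G0≡0) ⟨
    ∑ K (λ v → ∑ K (λ b → ∑ K (λ w → G-at b w v)))
      ≡⟨ ∑-comm K K (λ v b → ∑ K (λ w → G-at b w v)) ⟩
    ∑ K (λ b → ∑ K (λ v → ∑ K (λ w → G-at b w v)))
      ≡⟨ ∑-cong K (λ {b} _ → ∑-comm K K (λ v w → G-at b w v)) ⟩
    ∑ K (λ b → ∑ K (λ w → ∑ K (λ v → G-at b w v)))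
      ≡⟨ ∑-cong K (λ {b} _ → ∑-cong K (λ {w} _ →
           ∑-δ K (p ^ b * w) {λ v → ind (does (¬? (p ∣? w))) (G v)}
               (λ K≤u → trans (cong (ind (does (¬? (p ∣? w)))) (G-vanishes K≤u)) (ind-0 _)))) ⟩
    ∑ K (λ b → ∑ K (λ w → ind (does (¬? (p ∣? w))) (G (p ^ b * w)))) ∎
    where open ≡-Reasoning

-- Invariance under squares prime to p

%-*-≡1 : ∀ k .{{_ : NonZero k}} x {s} → s % k ≡ 1 → (x * s) % k ≡ x % k
%-*-≡1 k x {s} s≡1 = begin
  (x * s) % k              ≡⟨ %-distribˡ-* x s k ⟩
  ((x % k) * (s % k)) % k  ≡⟨ cong (λ r → ((x % k) * r) % k) s≡1 ⟩
  ((x % k) * 1) % k        ≡⟨ cong (_% k) (*-identityʳ (x % k)) ⟩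
  (x % k) % k              ≡⟨ m%n%n≡m%n x k ⟩
  x % k                    ∎
  where open ≡-Reasoning

odd⇒square%8≡1 : ∀ {u} → Odd u → (u * u) % 8 ≡ 1
odd⇒square%8≡1 {u} u-odd =
  trans (%-distribˡ-* u u 8) (check (u % 8) (m%n<n u 8) (u-odd ∘ ∣n∣m%n⇒∣m (divides 4 refl)))
  where
  check : ∀ r → r < 8 → ¬ 2 ∣ r → (r * r) % 8 ≡ 1
  check 1 _ _ = refl
  check 3 _ _ = refl
  check 5 _ _ = refl
  check 7 _ _ = refl
  check 0 _ r-odd = contradiction (divides 0 refl) r-odd
  check 2 _ r-odd = contradiction (divides 1 refl) r-odd
  check 4 _ r-odd = contradiction (divides 2 refl) r-odd
  check 6 _ r-odd = contradiction (divides 3 refl) r-odd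
  check (suc (suc (suc (suc (suc (suc (suc (suc _))))))))
        (s≤s (s≤s (s≤s (s≤s (s≤s (s≤s (s≤s (s≤s ())))))))) _

isDiscᵇ-*-oddSquare : ∀ x {u} → Odd u → isDiscᵇ (x * (u * u)) ≡ isDiscᵇ x
isDiscᵇ-*-oddSquare x {u} u-odd = cong (λ r → (r ≡ᵇ 0) ∨ (r ≡ᵇ 1)) (%-*-≡1 4 x u*u%4≡1)
  where
  u*u%4≡1 : (u * u) % 4 ≡ 1
  u*u%4≡1 = trans (sym (m∣n⇒o%n%m≡o%m 4 8 (u * u) (divides 2 refl))) (cong (_% 4) (odd⇒square%8≡1 u-odd))

isDiscᵇ-*-square : ∀ {x} u → T (isDiscᵇ x) → T (isDiscᵇ (x * (u * u)))
isDiscᵇ-*-square {x} u x-disc with 2 ∣? u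
... | no  u-odd = subst T (sym (isDiscᵇ-*-oddSquare x u-odd)) x-disc
... | yes 2∣u   = subst (λ r → T ((r ≡ᵇ 0) ∨ (r ≡ᵇ 1))) (sym (n∣m⇒m%n≡0 _ 4 4∣xuu)) tt
  where
  4∣xuu : 4 ∣ x * (u * u)
  4∣xuu = ∣n⇒∣m*n x (*-pres-∣ 2∣u 2∣u)

isDiscᵇ-divN-oddSquare : ∀ {m u} → Odd u → u * u ∣ m → T (isDiscᵇ m) → T (isDiscᵇ (divN m (u * u)))
isDiscᵇ-divN-oddSquare {u = u} u-odd (divides y refl) m-disc =
  subst T (trans (isDiscᵇ-*-oddSquare y u-odd) (cong isDiscᵇ (sym (divN-* y (u * u))))) m-disc
  where instance
    u≢0 = ¬p∣w⇒w≢0 u-odd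
    u²≢0 = m*n≢0 u u

kron2-*-oddSquare : ∀ x {u} → Odd u → kron2 (x * (u * u)) ≡ kron2 x
kron2-*-oddSquare x {u} u-odd = kron2-cong {x * (u * u)} {x} (%-*-≡1 8 x {u * u} (odd⇒square%8≡1 u-odd))
  where
  kron2-cong : ∀ {a b} → a % 8 ≡ b % 8 → kron2 a ≡ kron2 b
  kron2-cong {a} {b} eq with a % 8 | b % 8 | eq
  ... | r | .r | refl = refl

isSqModᵇ-transfer : ∀ k {a b} s → (a * (s * s)) % suc k ≡ b % suc k →
                    T (isSqModᵇ a (suc k)) → T (isSqModᵇ b (suc k))
isSqModᵇ-transfer k {a} {b} s as²≡b a-square with find (any⁻ _ (upTo (suc k)) a-square)
... | y , _ , y²≡a = any⁺ _ (lose (∈-upTo⁺ (m%n<n (y * s) q)) (≡⇒≡ᵇ _ _ ys²≡b))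
  where
  q = suc k
  ys = (y * s) % q
  square-* : ∀ y s → (y * s) * (y * s) ≡ (y * y) * (s * s)
  square-* = solve-∀
  y²%q≡a%q : (y * y) % q ≡ a % q
  y²%q≡a%q = ≡ᵇ⇒≡ ((y * y) % q) (a % q) y²≡a
  ys²≡b : (ys * ys) % q ≡ b % q
  ys²≡b = begin
    (ys * ys) % q                        ≡⟨ %-distribˡ-* (y * s) (y * s) q ⟨
    ((y * s) * (y * s)) % q              ≡⟨ cong (_% q) (square-* y s) ⟩
    ((y * y) * (s * s)) % q              ≡⟨ %-distribˡ-* (y * y) (s * s) q ⟩
    ((y * y) % q * ((s * s) % q)) % q    ≡⟨ cong (λ r → (r * ((s * s) % q)) % q) y²%q≡a%q ⟩
    (a % q * ((s * s) % q)) % q          ≡⟨ %-distribˡ-* a (s * s) q ⟨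
    (a * (s * s)) % q                    ≡⟨ as²≡b ⟩
    b % q                                ∎
    where open ≡-Reasoning

prime∤⇒coprime : ∀ {q u} → Prime q → ¬ q ∣ u → Coprime u q
prime∤⇒coprime q-prime q∤u (d∣u , d∣q) with prime⇒irreducible q-prime d∣q
... | inj₁ d≡1  = d≡1
... | inj₂ refl = contradiction d∣u q∤u

c≡1⇒c²%q≡1 : ∀ {q} .{{_ : NonZero q}} → 1 < q → ∀ {c} y → 1 + y * q ≡ c → (c * c) % q ≡ 1
c≡1⇒c²%q≡1 {q} 1<q y refl = begin
  ((1 + y * q) * (1 + y * q)) % q    ≡⟨ cong (_% q) (expand y q) ⟩
  (1 + (2 * y + y * y * q) * q) % q  ≡⟨ [m+kn]%n≡m%n 1 (2 * y + y * y * q) q ⟩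
  1 % q                              ≡⟨ m<n⇒m%n≡m 1<q ⟩
  1                                  ∎
  where
  open ≡-Reasoning
  expand : ∀ y q → (1 + y * q) * (1 + y * q) ≡ 1 + (2 * y + y * y * q) * q
  expand = solve-∀

c≡-1⇒c²%q≡1 : ∀ {q} .{{_ : NonZero q}} → 1 < q → ∀ {c} y → 1 + c ≡ y * q → (c * c) % q ≡ 1
c≡-1⇒c²%q≡1 {q} 1<q {c} y 1+c≡yq = begin
  (c * c) % q                ≡⟨ [m+kn]%n≡m%n (c * c) (2 * y) q ⟨
  (c * c + 2 * y * q) % q    ≡⟨ cong (_% q) c²+2yq≡1+y²q² ⟩
  (1 + (y * y * q) * q) % q  ≡⟨ [m+kn]%n≡m%n 1 (y * y * q) q ⟩
  1 % q                      ≡⟨ m<n⇒m%n≡m 1<q ⟩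
  1                          ∎
  where
  open ≡-Reasoning
  reassoc : ∀ c y q → c * c + 2 * y * q ≡ c * c + 2 * (y * q)
  reassoc = solve-∀
  complete-square : ∀ c → c * c + 2 * (1 + c) ≡ 1 + (1 + c) * (1 + c)
  complete-square = solve-∀
  square-* : ∀ y q → 1 + (y * q) * (y * q) ≡ 1 + (y * y * q) * q
  square-* = solve-∀
  c²+2yq≡1+y²q² : c * c + 2 * y * q ≡ 1 + (y * y * q) * q
  c²+2yq≡1+y²q² = begin
    c * c + 2 * y * q      ≡⟨ reassoc c y q ⟩
    c * c + 2 * (y * q)    ≡⟨ cong (λ z → c * c + 2 * z) 1+c≡yq ⟨
    c * c + 2 * (1 + c)    ≡⟨ complete-square c ⟩
    1 + (1 + c) * (1 + c)  ≡⟨ cong (λ z → 1 + z * z) 1+c≡yq ⟩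
    1 + (y * q) * (y * q)  ≡⟨ square-* y q ⟩
    1 + (y * y * q) * q    ∎

square-invertible-mod : ∀ {q} .{{_ : NonZero q}} → Prime q → ∀ {u} → ¬ q ∣ u →
                        ∃ λ t → ((t * u) * (t * u)) % q ≡ 1
square-invertible-mod q-prime q∤u with coprime-Bézout (prime∤⇒coprime q-prime q∤u)
... | Bézout.+- x y 1+yq≡xu = x , c≡1⇒c²%q≡1 (prime⇒≥2 q-prime) y 1+yq≡xu
... | Bézout.-+ x y 1+xu≡yq = x , c≡-1⇒c²%q≡1 (prime⇒≥2 q-prime) y 1+xu≡yq

isSqModᵇ-*-square : ∀ {q} → Prime q → ∀ x {u} → ¬ q ∣ u → isSqModᵇ (x * (u * u)) q ≡ isSqModᵇ x q
isSqModᵇ-*-square {zero} q-prime = contradiction q-prime ¬prime[0]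
isSqModᵇ-*-square {suc k} q-prime x {u} q∤u with square-invertible-mod q-prime q∤u
... | t , [tu]²≡1 = does-⇔ (mk⇔ (isSqModᵇ-transfer k {x * (u * u)} {x} t xu²t²≡x)
                                (isSqModᵇ-transfer k {x} {x * (u * u)} u refl))
                        (T? (isSqModᵇ (x * (u * u)) (suc k))) (T? (isSqModᵇ x (suc k)))
  where
  regroup : ∀ x u t → x * (u * u) * (t * t) ≡ x * ((t * u) * (t * u))
  regroup = solve-∀
  xu²t²≡x : (x * (u * u) * (t * t)) % suc k ≡ x % suc k
  xu²t²≡x = trans (cong (_% suc k) (regroup x u t)) (%-*-≡1 (suc k) x [tu]²≡1)

legendre-*-square : ∀ {q} → Prime q → ∀ x {u} → ¬ q ∣ u → legendre (x * (u * u)) q ≡ legendre x q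
legendre-*-square {q} q-prime x {u} q∤u with q ∣? x * (u * u) | q ∣? x
... | yes _      | yes _   = refl
... | yes q∣xu²  | no q∤x  = contradiction (q∣x q∣xu²) q∤x
  where
  q∣x : q ∣ x * (u * u) → q ∣ x
  q∣x q∣xu² with euclidsLemma x (u * u) q-prime q∣xu²
  ... | inj₁ q∣x  = q∣x
  ... | inj₂ q∣u² = contradiction (prime∣m*m⇒prime∣m q-prime q∣u²) q∤u
... | no q∤xu²   | yes q∣x = contradiction (∣m⇒∣m*n (u * u) q∣x) q∤xu²
... | no _       | no _    = cong (λ b → if b then ℤ.+ 1 else ℤ.-[1+ 0 ]) (isSqModᵇ-*-square q-prime x q∤u)

chi-*-square : ∀ {p} → Prime p → ∀ x {u} → ¬ p ∣ u → chi (x * (u * u)) p ≡ chi x p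
chi-*-square {0} p-prime = contradiction p-prime ¬prime[0]
chi-*-square {1} p-prime = contradiction p-prime ¬prime[1]
chi-*-square {2} _ x 2∤u = kron2-*-oddSquare x 2∤u
chi-*-square {suc (suc (suc _))} p-prime x p∤u = legendre-*-square p-prime x p∤u

localQ-*-square : ∀ {q} → Prime q → ∀ x {u} → ¬ q ∣ u → localQ (x * (u * u)) q ≡ localQ x q
localQ-*-square {q} q-prime x {u} q∤u with (q * q) ∣? x * (u * u) | (q * q) ∣? x
... | yes _         | yes _    = refl
... | yes q²∣xu²    | no q²∤x  = contradiction (q²∣x q²∣xu²) q²∤x
  where
  q²≡q^2 : q * q ≡ q ^ 2
  q²≡q^2 = cong (q *_) (sym (*-identityʳ q))
  q²∣x : q * q ∣ x * (u * u) → q * q ∣ x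
  q²∣x h = subst (_∣ x) (sym q²≡q^2)
    (p^k∣m*n⇒p^k∣n q-prime (q∤u ∘ prime∣m*m⇒prime∣m q-prime) 2
      (subst₂ _∣_ q²≡q^2 (*-comm x (u * u)) h))
... | no q²∤xu²     | yes q²∣x = contradiction (∣m⇒∣m*n (u * u) q²∣x) q²∤xu²
... | no _          | no _     = cong (λ z → fracZ (ℤ.+ 1 ℤ.+ z) 1) (legendre-*-square q-prime x q∤u)

T-does⇒ : ∀ {A : Set} (a? : Dec A) → T (does a?) → A
T-does⇒ (yes a) _ = a

T-does⇐ : ∀ {A : Set} (a? : Dec A) → A → T (does a?)
T-does⇐ (yes _) _ = tt
T-does⇐ (no ¬a) a = contradiction a ¬a

-- smoothᵇ P from Defs is smoothOverᵇ (does ∘ (_≤? P)) by definition.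
smoothOverᵇ : (ℕ → Bool) → ℕ → Bool
smoothOverᵇ ok v = all (λ q → not (does (prime? q) ∧ does (q ∣? v)) ∨ ok q) (upTo (suc v))

smoothOverᵇ⇔ : ∀ {P : ℕ → Set} (P? : Decidable P) {v} → .{{NonZero v}} →
               T (smoothOverᵇ (does ∘ P?) v) ⇔ (∀ {q} → Prime q → q ∣ v → P q)
smoothOverᵇ⇔ {P} P? {v} = mk⇔ to from
  where
  clause : ℕ → Bool
  clause q = not (does (prime? q) ∧ does (q ∣? v)) ∨ does (P? q)
  to : T (all clause (upTo (suc v))) → ∀ {q} → Prime q → q ∣ v → P q
  to smooth {q} q-prime q∣v = T-does⇒ (P? q) (modusPonens (dec-true (prime? q) q-prime) (dec-true (q ∣? v) q∣v)
    (All.lookup (All.all⁺ clause (upTo (suc v)) smooth) (∈-upTo⁺ (s≤s (∣⇒≤ q∣v)))))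
    where
    modusPonens : ∀ {a b c} → a ≡ true → b ≡ true → T (not (a ∧ b) ∨ c) → T c
    modusPonens refl refl c = c
  from : (∀ {q} → Prime q → q ∣ v → P q) → T (all clause (upTo (suc v)))
  from h = All.all⁻ clause {upTo (suc v)} (All.tabulate λ {q} _ → check q)
    where
    check : ∀ q → T (clause q)
    check q with prime? q | q ∣? v
    ... | no  _       | _       = tt
    ... | yes _       | no  _   = tt
    ... | yes q-prime | yes q∣v = T-does⇐ (P? q) (h q-prime q∣v)

smoothOverᵇ-cong : ∀ {P R : ℕ → Set} (P? : Decidable P) (R? : Decidable R) →
                   (∀ {q} → Prime q → P q ⇔ R q) → ∀ {v} → .{{NonZero v}} →
                   smoothOverᵇ (does ∘ P?) v ≡ smoothOverᵇ (does ∘ R?) v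
smoothOverᵇ-cong P? R? P⇔R {v} = does-⇔ (mk⇔
  (λ smooth → Equivalence.from (smoothOverᵇ⇔ R?) λ q-prime q∣v →
    Equivalence.to (P⇔R q-prime) (Equivalence.to (smoothOverᵇ⇔ P?) smooth q-prime q∣v))
  (λ smooth → Equivalence.from (smoothOverᵇ⇔ P?) λ q-prime q∣v →
    Equivalence.from (P⇔R q-prime) (Equivalence.to (smoothOverᵇ⇔ R?) smooth q-prime q∣v)))
  (T? (smoothOverᵇ (does ∘ P?) v)) (T? (smoothOverᵇ (does ∘ R?) v))

-- The Euler product

-- m stands for n² − 4 and H p x for the weight at p of the discriminant x, so that
-- summand (primes ≤ P) v is the v-th term of β_{P,Q}(n) and localSummand p b the b-th
-- term of β_(p,Q)(n).
module EulerProduct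
  (m : ℕ) .{{_ : NonZero m}} (m-disc : T (isDiscᵇ m))
  (H : ℕ → ℕ → ℚ)
  (H-*-square : ∀ {p} → Prime p → ∀ x {u} → ¬ p ∣ u → H p (x * (u * u)) ≡ H p x)
  where

  smoothOver : List ℕ → ℕ → Bool
  smoothOver L = smoothOverᵇ (does ∘ (_∈? L))

  Admissible : List ℕ → ℕ → Set
  Admissible L v = 1 ≤ v × v * v ∣ m × T (isDiscᵇ (divN m (v * v))) × T (smoothOver L v)

  admissible? : ∀ L v → Dec (Admissible L v)
  admissible? L v = 1 ≤? v ×-dec v * v ∣? m ×-dec T? (isDiscᵇ (divN m (v * v))) ×-dec T? (smoothOver L v)

  term : List ℕ → ℕ → ℚ
  term L v = recip (ℕtoℚ v) · prodℚ (map (λ p → H p (divN m (v * v))) L)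

  summand : List ℕ → ℕ → ℚ
  summand L v = ind (does (admissible? L v)) (term L v)

  LocallyAdmissible : ℕ → ℕ → Set
  LocallyAdmissible p b = p ^ (2 * b) ∣ m × T (isDiscᵇ (divN m (p ^ (2 * b))))

  locallyAdmissible? : ∀ p b → Dec (LocallyAdmissible p b)
  locallyAdmissible? p b = p ^ (2 * b) ∣? m ×-dec T? (isDiscᵇ (divN m (p ^ (2 * b))))

  localTerm : ℕ → ℕ → ℚ
  localTerm p b = recip (ℕtoℚ (p ^ b)) · H p (divN m (p ^ (2 * b)))

  localSummand : ℕ → ℕ → ℚ
  localSummand p b = ind (does (locallyAdmissible? p b)) (localTerm p b)

  summand-vanishes : ∀ {L v} → ¬ Admissible L v → summand L v ≡ 0ℚ
  summand-vanishes {L} {v} ¬adm = cong (λ c → ind c (term L v)) (dec-false (admissible? L v) ¬adm)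

  summand-> : ∀ L {v} → m < v → summand L v ≡ 0ℚ
  summand-> L {v} m<v = summand-vanishes {L} λ (1≤v , v²∣m , _) → <⇒≱ m<v (v≤m 1≤v v²∣m)
    where
    v≤m : 1 ≤ v → v * v ∣ m → v ≤ m
    v≤m 1≤v v²∣m = ≤-trans (m≤m*n v v {{>-nonZero 1≤v}}) (∣⇒≤ v²∣m)

  summand-∣ : ∀ {L p} → Prime p → p ∉ L → ∀ {w} → p ∣ w → summand L w ≡ 0ℚ
  summand-∣ {L} {p} p-prime p∉L p∣w = summand-vanishes {L} λ (1≤w , _ , _ , smooth) →
    p∉L (Equivalence.to (smoothOverᵇ⇔ (_∈? L) {{>-nonZero 1≤w}}) smooth p-prime p∣w)

  summand-[] : ∀ v → summand [] v ≡ ind (does (v ≟ 1)) 1ℚ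
  summand-[] v = ind-does-cong (admissible? [] v) (does-⇔ admissible⇔ (admissible? [] v) (v ≟ 1))
                               (term≡1 ∘ Equivalence.to admissible⇔)
    where
    term≡1 : v ≡ 1 → term [] v ≡ 1ℚ
    term≡1 refl = refl
    admissible⇔ : Admissible [] v ⇔ v ≡ 1
    admissible⇔ = mk⇔
      (λ (1≤v , _ , _ , smooth) → noPrimeDivisor⇒≡1 {{>-nonZero 1≤v}}
        λ q-prime q∣v → ¬Any[] (Equivalence.to (smoothOverᵇ⇔ (_∈? []) {{>-nonZero 1≤v}}) smooth q-prime q∣v))
      λ { refl → ≤-refl , 1∣ m , subst (T ∘ isDiscᵇ) (sym (n/1≡n m)) m-disc
               , Equivalence.from (smoothOverᵇ⇔ (_∈? []))
                   (λ q-prime q∣1 → contradiction (subst Prime (∣1⇒≡1 q∣1) q-prime) ¬prime[1]) }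

  module _ {p} (p-prime : Prime p) {L} (p∉L : p ∉ L) (L-primes : All Prime L) (b : ℕ) {w} (p∤w : ¬ p ∣ w) where

    private
      u = p ^ b
      v = u * w
      instance
        w≢0 = ¬p∣w⇒w≢0 p∤w
        u≢0 = m^n≢0 p b {{prime⇒nonZero p-prime}}
        v≢0 = m*n≢0 u w
        w²≢0 = m*n≢0 w w
        u²≢0 = m*n≢0 u u
        v²≢0 = m*n≢0 v v

      regroupᵘ : ∀ s u w → s * ((u * w) * (u * w)) ≡ s * (w * w) * (u * u)
      regroupᵘ = solve-∀
      regroupʷ : ∀ s u w → s * ((u * w) * (u * w)) ≡ s * (u * u) * (w * w)
      regroupʷ = solve-∀

      module Quotients {s} (m≡s*v² : m ≡ s * (v * v)) where
        m/v² : divN m (v * v) ≡ s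
        m/v² = trans (cong (λ x → divN x (v * v)) m≡s*v²) (divN-* s (v * v))
        m/p^2b : divN m (p ^ (2 * b)) ≡ s * (w * w)
        m/p^2b = trans (cong₂ divN (trans m≡s*v² (regroupᵘ s u w)) (^-double p b)) (divN-* (s * (w * w)) (u * u))
        m/w² : divN m (w * w) ≡ s * (u * u)
        m/w² = trans (cong (λ x → divN x (w * w)) (trans m≡s*v² (regroupʷ s u w))) (divN-* (s * (u * u)) (w * w))

    square∣⇔ : v * v ∣ m ⇔ (p ^ (2 * b) ∣ m × w * w ∣ m)
    square∣⇔ = mk⇔
      (λ v²∣m → ∣-trans p^2b∣v² v²∣m , ∣-trans (*-pres-∣ (n∣m*n u) (n∣m*n u)) v²∣m)
      λ (p^2b∣m , divides r m≡r*w²) → v²∣m m≡r*w²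
        (p^k∣m*n⇒p^k∣n p-prime (p∤w ∘ prime∣m*m⇒prime∣m p-prime) (2 * b)
          (subst (p ^ (2 * b) ∣_) (trans m≡r*w² (*-comm r (w * w))) p^2b∣m))
      where
      p^2b∣v² : p ^ (2 * b) ∣ v * v
      p^2b∣v² = subst (_∣ v * v) (sym (^-double p b)) (*-pres-∣ (m∣m*n {u} w) (m∣m*n {u} w))
      v²∣m : ∀ {r} → m ≡ r * (w * w) → p ^ (2 * b) ∣ r → v * v ∣ m
      v²∣m {r} m≡r*w² (divides s r≡s*p^2b) = divides s (begin
        m                          ≡⟨ m≡r*w² ⟩
        r * (w * w)                ≡⟨ cong (λ x → x * (w * w)) (trans r≡s*p^2b (cong (s *_) (^-double p b))) ⟩
        s * (u * u) * (w * w)      ≡⟨ regroupʷ s u w ⟨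
        s * (v * v)                ∎)
        where open ≡-Reasoning

    isDisc-split : ∀ s → T (isDiscᵇ s) ⇔ (T (isDiscᵇ (s * (w * w))) × T (isDiscᵇ (s * (u * u))))
    isDisc-split s = mk⇔ (λ s-disc → isDiscᵇ-*-square {s} w s-disc , isDiscᵇ-*-square {s} u s-disc) from
      where
      from : T (isDiscᵇ (s * (w * w))) × T (isDiscᵇ (s * (u * u))) → T (isDiscᵇ s)
      from (sw²-disc , su²-disc) with p ≟ 2
      ... | yes refl = subst T (isDiscᵇ-*-oddSquare s p∤w) sw²-disc
      ... | no  p≢2  = subst T (isDiscᵇ-*-oddSquare s u-odd) su²-disc
        where
        u-odd : Odd u
        u-odd 2∣u = p≢2 (sym (prime∣p^b⇒≡ prime[2] p-prime b 2∣u))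

    isDisc-split-quotients : v * v ∣ m → T (isDiscᵇ (divN m (v * v))) ⇔
                             (T (isDiscᵇ (divN m (p ^ (2 * b)))) × T (isDiscᵇ (divN m (w * w))))
    isDisc-split-quotients (divides s m≡s*v²)
      rewrite Quotients.m/v² {s} m≡s*v² | Quotients.m/p^2b {s} m≡s*v² | Quotients.m/w² {s} m≡s*v² = isDisc-split s

    smooth-split : T (smoothOver (p ∷ L) v) ⇔ T (smoothOver L w)
    smooth-split = mk⇔
      (λ smooth → from-smooth L λ q-prime q∣w → drop-p (to-smooth (p ∷ L) smooth q-prime (∣n⇒∣m*n u q∣w)) q∣w)
      (λ smooth → from-smooth (p ∷ L) λ {q} q-prime q∣v → case-split q-prime (to-smooth L smooth q-prime) q∣v)
      where
      to-smooth : ∀ L′ {x} → .{{NonZero x}} → T (smoothOver L′ x) → ∀ {q} → Prime q → q ∣ x → q ∈ L′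
      to-smooth L′ = Equivalence.to (smoothOverᵇ⇔ (_∈? L′))
      from-smooth : ∀ L′ {x} → .{{NonZero x}} → (∀ {q} → Prime q → q ∣ x → q ∈ L′) → T (smoothOver L′ x)
      from-smooth L′ = Equivalence.from (smoothOverᵇ⇔ (_∈? L′))
      drop-p : ∀ {q} → q ∈ p ∷ L → q ∣ w → q ∈ L
      drop-p (here refl) p∣w = contradiction p∣w p∤w
      drop-p (there q∈L) _   = q∈L
      case-split : ∀ {q} → Prime q → (q ∣ w → q ∈ L) → q ∣ v → q ∈ p ∷ L
      case-split {q} q-prime in-L q∣v with euclidsLemma u w q-prime q∣v
      ... | inj₁ q∣u = here (prime∣p^b⇒≡ q-prime p-prime b q∣u)
      ... | inj₂ q∣w = there (in-L q∣w)

    admissible-∷⇔ : Admissible (p ∷ L) v ⇔ (LocallyAdmissible p b × Admissible L w)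
    admissible-∷⇔ = mk⇔
      (λ (_ , v²∣m , disc , smooth) →
        let p^2b∣m , w²∣m = Equivalence.to square∣⇔ v²∣m
            disc-p , disc-w = Equivalence.to (isDisc-split-quotients v²∣m) disc
        in (p^2b∣m , disc-p) , (>-nonZero⁻¹ w , w²∣m , disc-w , Equivalence.to smooth-split smooth))
      (λ ((p^2b∣m , disc-p) , (_ , w²∣m , disc-w , smooth)) →
        let v²∣m = Equivalence.from square∣⇔ (p^2b∣m , w²∣m)
        in >-nonZero⁻¹ v , v²∣m , Equivalence.from (isDisc-split-quotients v²∣m) (disc-p , disc-w)
         , Equivalence.from smooth-split smooth)

    term-∷ : v * v ∣ m → term (p ∷ L) v ≡ localTerm p b · term L w
    term-∷ (divides s m≡s*v²) = begin
      recip (ℕtoℚ v) · (H p (divN m (v * v)) · Π (divN m (v * v)))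
        ≡⟨ cong (λ x → recip (ℕtoℚ v) · (H p x · Π x)) m/v² ⟩
      recip (ℕtoℚ (u * w)) · (H p s · Π s)
        ≡⟨ cong (_· (H p s · Π s)) (recip-ℕtoℚ-* u w) ⟩
      (recip (ℕtoℚ u) · recip (ℕtoℚ w)) · (H p s · Π s)
        ≡⟨ interchange (recip (ℕtoℚ u)) (recip (ℕtoℚ w)) (H p s) (Π s) ⟩
      (recip (ℕtoℚ u) · H p s) · (recip (ℕtoℚ w) · Π s)
        ≡⟨ cong₂ (λ x y → (recip (ℕtoℚ u) · x) · (recip (ℕtoℚ w) · y)) H≡ Π≡ ⟨
      (recip (ℕtoℚ u) · H p (divN m (p ^ (2 * b)))) · (recip (ℕtoℚ w) · Π (divN m (w * w))) ∎
      where
      open ≡-Reasoning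
      open Quotients {s} m≡s*v²
      Π : ℕ → ℚ
      Π x = prodℚ (map (λ q → H q x) L)
      H≡ : H p (divN m (p ^ (2 * b))) ≡ H p s
      H≡ = trans (cong (H p) m/p^2b) (H-*-square p-prime s p∤w)
      q∤u : ∀ {q} → q ∈ L → ¬ q ∣ u
      q∤u q∈L q∣u = p∉L (subst (_∈ L) (prime∣p^b⇒≡ (All.lookup L-primes q∈L) p-prime b q∣u) q∈L)
      Π≡ : Π (divN m (w * w)) ≡ Π s
      Π≡ = trans (cong Π m/w²)
                 (prodℚ-cong (All.tabulate λ q∈L → H-*-square (All.lookup L-primes q∈L) s (q∤u q∈L)))

    summand-∷ : summand (p ∷ L) v ≡ localSummand p b · summand L w
    summand-∷ = begin
      ind (does (admissible? (p ∷ L) v)) (term (p ∷ L) v)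
        ≡⟨ ind-does-cong (admissible? (p ∷ L) v)
             (does-⇔ admissible-∷⇔ (admissible? (p ∷ L) v) (locallyAdmissible? p b ×-dec admissible? L w))
             (λ (_ , v²∣m , _) → term-∷ v²∣m) ⟩
      ind (does (locallyAdmissible? p b) ∧ does (admissible? L w)) (localTerm p b · term L w)
        ≡⟨ ind-∧-* (does (locallyAdmissible? p b)) (does (admissible? L w)) (localTerm p b) (term L w) ⟩
      localSummand p b · summand L w ∎
      where open ≡-Reasoning

  eulerProduct : ∀ {L} → All Prime L → Unique L → ∀ {K} → m < K →
              ∑ K (summand L) ≡ prodℚ (map (λ p → ∑ K (localSummand p)) L)
  eulerProduct [] [] {K} m<K = begin
    ∑ K (summand [])                    ≡⟨ ∑-cong K (λ {v} _ → summand-[] v) ⟩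
    ∑ K (λ v → ind (does (v ≟ 1)) 1ℚ)  ≡⟨ ∑-δ K 1 (λ K≤1 → contradiction (≤-trans m<K K≤1) (<⇒≱ (s≤s (>-nonZero⁻¹ m)))) ⟩
    1ℚ                                  ∎
    where open ≡-Reasoning
  eulerProduct {p ∷ L} (p-prime ∷ L-primes) (p≢L ∷ L-unique) {K} m<K = begin
    ∑ K (summand (p ∷ L))
      ≡⟨ ∑-p-adic p-prime K (summand (p ∷ L)) refl (λ K≤v → summand-> (p ∷ L) (<-≤-trans m<K K≤v)) ⟩
    ∑ K (λ b → ∑ K (λ w → ind (does (¬? (p ∣? w))) (summand (p ∷ L) (p ^ b * w))))
      ≡⟨ ∑-cong K (λ {b} _ → ∑-cong K (λ {w} _ → split b w)) ⟩
    ∑ K (λ b → ∑ K (λ w → localSummand p b · summand L w))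
      ≡⟨ ∑-*-∑ K K (localSummand p) (summand L) ⟩
    ∑ K (localSummand p) · ∑ K (summand L)
      ≡⟨ cong (∑ K (localSummand p) ·_) (eulerProduct L-primes L-unique m<K) ⟩
    ∑ K (localSummand p) · prodℚ (map (λ p → ∑ K (localSummand p)) L) ∎
    where
    open ≡-Reasoning
    p∉L : p ∉ L
    p∉L = All.All¬⇒¬Any p≢L
    split : ∀ b w → ind (does (¬? (p ∣? w))) (summand (p ∷ L) (p ^ b * w)) ≡ localSummand p b · summand L w
    split b w with p ∣? w
    ... | yes p∣w = sym (trans (cong (localSummand p b ·_) (summand-∣ p-prime p∉L p∣w))
                               (ℚ.*-zeroʳ (localSummand p b)))
    ... | no  p∤w = summand-∷ p-prime p∉L L-primes b p∤w

primesUpTo-primes : ∀ P → All Prime (primesUpTo P)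
primesUpTo-primes P = All.all-filter prime? (upTo (suc P))

primesUpTo-unique : ∀ P → Unique (primesUpTo P)
primesUpTo-unique P = Unique.filter⁺ prime? (Unique.upTo⁺ (suc P))

∈-primesUpTo⇔ : ∀ {P q} → Prime q → q ∈ primesUpTo P ⇔ q ≤ P
∈-primesUpTo⇔ {P} q-prime = mk⇔
  (λ q∈ → ≤-pred (∈-upTo⁻ (proj₁ (∈-filter⁻ prime? {xs = upTo (suc P)} q∈))))
  (λ q≤P → ∈-filter⁺ prime? (∈-upTo⁺ (s≤s q≤P)) q-prime)

filter-∣-primesUpTo : ∀ {Q P} → .{{NonZero Q}} → Q ≤ P → filter (_∣? Q) (primesUpTo P) ≡ primeDivisors Q
filter-∣-primesUpTo {Q} Q≤P = go (≤⇒≤′ Q≤P)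
  where
  go : ∀ {P} → Q ≤′ P → filter (_∣? Q) (primesUpTo P) ≡ primeDivisors Q
  go ≤′-refl = refl
  go (≤′-step {P} Q≤′P) = begin
    filter (_∣? Q) (filter prime? (upTo (suc (suc P))))
      ≡⟨ cong (filter (_∣? Q) ∘ filter prime?) (upTo-∷ʳ (suc P)) ⟨
    filter (_∣? Q) (filter prime? (upTo (suc P) ++ [ suc P ]))
      ≡⟨ cong (filter (_∣? Q)) (filter-++ prime? (upTo (suc P)) [ suc P ]) ⟩
    filter (_∣? Q) (primesUpTo P ++ filter prime? [ suc P ])
      ≡⟨ filter-++ (_∣? Q) (primesUpTo P) (filter prime? [ suc P ]) ⟩
    filter (_∣? Q) (primesUpTo P) ++ filter (_∣? Q) (filter prime? [ suc P ])
      ≡⟨ cong₂ _++_ (go Q≤′P) (filter-none (_∣? Q) (All.filter⁺ prime? (P+1∤Q ∷ []))) ⟩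
    primeDivisors Q ++ []
      ≡⟨ ++-identityʳ (primeDivisors Q) ⟩
    primeDivisors Q ∎
    where
    open ≡-Reasoning
    P+1∤Q : ¬ suc P ∣ Q
    P+1∤Q = >⇒∤ (s≤s (≤′⇒≤ Q≤′P))

disc≢0 : ∀ {n} → 3 ≤ n → NonZero (disc n)
disc≢0 {n} 3≤n = >-nonZero (≤-trans (s≤s z≤n) (∸-monoˡ-≤ 4 (*-mono-≤ 3≤n 3≤n)))

disc-isDisc : ∀ {n} → 3 ≤ n → T (isDiscᵇ (disc n))
disc-isDisc {n} 3≤n = subst T (cong (λ r → (r ≡ᵇ 0) ∨ (r ≡ᵇ 1)) n²%4≡disc%4) (isDiscᵇ-*-square {1} n tt)
  where
  n*n≥9 : 9 ≤ n * n
  n*n≥9 = *-mono-≤ 3≤n 3≤n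
  n²%4≡disc%4 : (1 * (n * n)) % 4 ≡ disc n % 4
  n²%4≡disc%4 = begin
    (1 * (n * n)) % 4     ≡⟨ cong (_% 4) (*-identityˡ (n * n)) ⟩
    (n * n) % 4           ≡⟨ cong (_% 4) (m∸n+n≡m (≤-trans (s≤s (s≤s (s≤s (s≤s z≤n)))) n*n≥9)) ⟨
    (disc n + 4) % 4      ≡⟨ [m+n]%n≡m%n (disc n) 4 ⟩
    disc n % 4            ∎
    where open ≡-Reasoning

localFactor : ℕ → ℕ → ℕ → ℚ
localFactor Q p x = eulerInv p (chi x p) · (if does (p ∣? Q) then localQ x p else 1ℚ)

localFactor-*-square : ∀ Q {p} → Prime p → ∀ x {u} → ¬ p ∣ u →
                       localFactor Q p (x * (u * u)) ≡ localFactor Q p x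
localFactor-*-square Q {p} p-prime x p∤u with p ∣? Q
... | yes _ = cong₂ (λ χ z → eulerInv p χ · z) (chi-*-square p-prime x p∤u) (localQ-*-square p-prime x p∤u)
... | no  _ = cong (λ χ → eulerInv p χ · 1ℚ) (chi-*-square p-prime x p∤u)

module Beta (Q n : ℕ) (3≤n : 3 ≤ n) where

  open EulerProduct (disc n) {{disc≢0 3≤n}} (disc-isDisc 3≤n) (localFactor Q) (localFactor-*-square Q) public

  quotient-isDisc : ∀ {p} → Prime p → p ≢ 2 → ∀ {b} → p ^ (2 * b) ∣ disc n →
                    T (isDiscᵇ (divN (disc n) (p ^ (2 * b))))
  quotient-isDisc {p} p-prime p≢2 {b} p^2b∣m = subst (λ d → T (isDiscᵇ (divN (disc n) d))) (sym (^-double p b))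
    (isDiscᵇ-divN-oddSquare p^b-odd (subst (_∣ disc n) (^-double p b) p^2b∣m) (disc-isDisc 3≤n))
    where
    p^b-odd : Odd (p ^ b)
    p^b-odd 2∣p^b = p≢2 (sym (prime∣p^b⇒≡ prime[2] p-prime b 2∣p^b))

  indic≡ : Odd Q → ∀ {p} → Prime p → ∀ b → indic Q p b n ≡
           ind (does (locallyAdmissible? p b)) (if does (p ∣? Q) then localQ (divN (disc n) (p ^ (2 * b))) p else 1ℚ)
  indic≡ Q-odd {p} p-prime b with p ^ (2 * b) ∣? disc n
  ... | no  _ = refl
  ... | yes p^2b∣m with p ∣? Q
  ...   | yes p∣Q = sym (cong (λ c → ind c (localQ (divN (disc n) (p ^ (2 * b))) p))
                           (Equivalence.to T-≡ (quotient-isDisc p-prime p≢2 {b} p^2b∣m)))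
    where
    p≢2 : p ≢ 2
    p≢2 refl = Q-odd p∣Q
  ...   | no  _ with p ≟ 2
  ...     | yes refl = refl
  ...     | no p≢2   = sym (cong (λ c → ind c 1ℚ) (Equivalence.to T-≡ (quotient-isDisc p-prime p≢2 {b} p^2b∣m)))

  betaLoc≡∑localSummand : Odd Q → ∀ {p} → Prime p → betaLoc p Q n ≡ ∑ (suc (disc n)) (localSummand p)
  betaLoc≡∑localSummand Q-odd {p} p-prime =
    trans (sumℚ-map-upTo (betaLocTerm p Q n) (suc (disc n))) (∑-cong (suc (disc n)) (λ {b} _ → betaLocTerm≡ b))
    where
    betaLocTerm≡ : ∀ b → betaLocTerm p Q n b ≡ localSummand p b
    betaLocTerm≡ b = begin
      r · e · indic Q p b n  ≡⟨ cong (r · e ·_) (indic≡ Q-odd p-prime b) ⟩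
      r · e · ind c f        ≡⟨ ind-*ʳ c (r · e) f ⟩
      ind c (r · e · f)      ≡⟨ cong (ind c) (ℚ.*-assoc r e f) ⟩
      ind c (r · (e · f))    ∎
      where
      open ≡-Reasoning
      y = divN (disc n) (p ^ (2 * b))
      r = recip (ℕtoℚ (p ^ b))
      e = eulerInv p (chi y p)
      c = does (locallyAdmissible? p b)
      f = if does (p ∣? Q) then localQ y p else 1ℚ

  betaPQ≡∑summand : ∀ {P} → .{{NonZero Q}} → Q ≤ P →
                    betaPQ P Q n ≡ ∑ (suc (disc n)) (summand (primesUpTo P))
  betaPQ≡∑summand {P} Q≤P =
    trans (sumℚ-map-upTo (λ v → ind (betaCondᵇ P n v) (betaTerm P Q n v)) (suc (disc n)))
          (∑-cong (suc (disc n)) (λ {v} _ → summand≡ v))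
    where
    L = primesUpTo P
    summand≡ : ∀ v → ind (betaCondᵇ P n v) (betaTerm P Q n v) ≡ summand L v
    summand≡ zero       = refl
    summand≡ v@(suc _)  = cong₂ ind
      (cong (λ s → does (1 ≤? v) ∧ does (v * v ∣? disc n) ∧ isDiscᵇ (divN (disc n) (v * v)) ∧ s)
            (smoothOverᵇ-cong (_≤? P) (_∈? L) (λ q-prime → ⇔.sym (∈-primesUpTo⇔ q-prime)) {v}))
      betaTerm≡
      where
      open ≡-Reasoning
      D = divN (disc n) (v * v)
      r = recip (ℕtoℚ v)
      E = prodℚ (map (λ p → eulerInv p (chi D p)) L)
      Q-part : ℕ → ℚ
      Q-part p = if does (p ∣? Q) then localQ D p else 1ℚ
      betaTerm≡ : betaTerm P Q n v ≡ term L v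
      betaTerm≡ = begin
        r · E · prodℚ (map (localQ D) (primeDivisors Q))
          ≡⟨ cong (λ qs → r · E · prodℚ (map (localQ D) qs)) (filter-∣-primesUpTo Q≤P) ⟨
        r · E · prodℚ (map (localQ D) (filter (_∣? Q) L))
          ≡⟨ cong (r · E ·_) (prodℚ-filter (_∣? Q) (localQ D) L) ⟨
        r · E · prodℚ (map Q-part L)
          ≡⟨ ℚ.*-assoc r E _ ⟩
        r · (E · prodℚ (map Q-part L))
          ≡⟨ cong (r ·_) (prodℚ-map-* (λ p → eulerInv p (chi D p)) Q-part L) ⟨
        r · prodℚ (map (λ p → localFactor Q p D) L) ∎

mainTheorem10 : (Q P n : ℕ) → 1 ≤ Q → Odd Q → Squarefree Q → Q ≤ P → 3 ≤ n →
    betaPQ P Q n ≡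
      prodℚ (map (λ p → betaLoc p Q n) (primesUpToCoprime P Q))
        · prodℚ (map (λ q → betaLoc q Q n) (primeDivisors Q))
mainTheorem10 Q P n 1≤Q Q-odd _ Q≤P 3≤n = begin
  betaPQ P Q n
    ≡⟨ betaPQ≡∑summand Q≤P ⟩
  ∑ K (summand L)
    ≡⟨ eulerProduct (primesUpTo-primes P) (primesUpTo-unique P) ≤-refl ⟩
  prodℚ (map (λ p → ∑ K (localSummand p)) L)
    ≡⟨ prodℚ-cong (All.map (sym ∘ betaLoc≡∑localSummand Q-odd) (primesUpTo-primes P)) ⟩
  prodℚ (map β L)
    ≡⟨ prodℚ-partition (_∣? Q) β L ⟩
  prodℚ (map β (primesUpToCoprime P Q)) · prodℚ (map β (filter (_∣? Q) L))
    ≡⟨ cong (λ qs → prodℚ (map β (primesUpToCoprime P Q)) · prodℚ (map β qs)) (filter-∣-primesUpTo Q≤P) ⟩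
  prodℚ (map β (primesUpToCoprime P Q)) · prodℚ (map β (primeDivisors Q)) ∎
  where
  open ≡-Reasoning
  open Beta Q n 3≤n
  instance _ = >-nonZero 1≤Q
  K = suc (disc n)
  L = primesUpTo P
  β = λ p → betaLoc p Q n
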